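{- Let $G=(V,E)$ be a finite simple graph with nonnegative real vertex weights $w$, and suppose $G$ is a unique independence weighted graph with unique $\alpha$-set $I$. Then there exists $\epsilon>0$ such that for every weight function $w':V\to\mathbb{R}$ with $w(x)-\epsilon<w'(x)<w(x)+\epsilon$ for all $x\in V$, the graph $G$ with weights $w'$ is a unique independence weighted graph and $I$ is its unique $\alpha$-set.
   Context: For a weight function $u$ and $S\subseteq V$, $u(S)=\sum_{v\in S}u(v)$. An independent set is a set of pairwise nonadjacent vertices; an $\alpha$-set with respect to $u$ is an independent set of maximum $u$-weight, and the weighted graph is a unique independence weighted graph if it has exactly one $\alpha$-set. -}

module Defs where

open import Level using (Level; _⊔_; suc)
open import Data.Nat using (ℕ; zero) renaming (suc to sucℕ)
open import Data.Fin using (Fin)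
open import Data.Fin.Subset using (Subset; _∈_)
open import Data.Vec using ([]; _∷_)
open import Data.Bool using (Bool; true; false)
open import Data.Product using (_×_; Σ)
open import Data.Sum using (_⊎_)
open import Relation.Nullary using (¬_; Dec)
open import Relation.Binary.PropositionalEquality using (_≡_)
open import Relation.Binary.Definitions using (Symmetric)
open import Relation.Binary.Structures using (IsStrictTotalOrder)
open import Algebra.Bundles using (CommutativeRing)

record OrderedField (c ℓ₁ ℓ₂ : Level) : Set (suc (c ⊔ ℓ₁ ⊔ ℓ₂)) where
  field
    commutativeRing : CommutativeRing c ℓ₁
  open CommutativeRing commutativeRing public
  field
    _<_                : Carrier → Carrier → Set ℓ₂
    isStrictTotalOrder : IsStrictTotalOrder _≈_ _<_
    0≉1                : ¬ (0# ≈ 1#)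
    inverse            : ∀ x → ¬ (x ≈ 0#) → Σ Carrier (λ y → (x * y) ≈ 1#)
    +-mono-<           : ∀ {x y} z → x < y → (x + z) < (y + z)
    *-pos              : ∀ {x y} → 0# < x → 0# < y → 0# < (x * y)

  _≤_ : Carrier → Carrier → Set (ℓ₁ ⊔ ℓ₂)
  x ≤ y = (x < y) ⊎ (x ≈ y)

record Graph (n : ℕ) : Set₁ where
  field
    Adj     : Fin n → Fin n → Set
    adj?    : ∀ x y → Dec (Adj x y)
    sym     : Symmetric Adj
    irrefl  : ∀ x → ¬ Adj x x

module _ {c ℓ₁ ℓ₂} (F : OrderedField c ℓ₁ ℓ₂) where
  open OrderedField F

  weight : ∀ {n} → (Fin n → Carrier) → Subset n → Carrier
  weight {zero}   u []            = 0#
  weight {sucℕ n} u (true  ∷ S)  = u Fin.zero + weight (λ i → u (Fin.suc i)) S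
  weight {sucℕ n} u (false ∷ S)  = weight (λ i → u (Fin.suc i)) S

  Independent : ∀ {n} → Graph n → Subset n → Set
  Independent G S = ∀ x y → x ∈ S → y ∈ S → ¬ Graph.Adj G x y

  IsAlphaSet : ∀ {n} → Graph n → (Fin n → Carrier) → Subset n → Set (ℓ₁ ⊔ ℓ₂)
  IsAlphaSet G u I =
    Independent G I × (∀ J → Independent G J → weight u J ≤ weight u I)

  UniqueAlphaSet : ∀ {n} → Graph n → (Fin n → Carrier) → Subset n → Set (ℓ₁ ⊔ ℓ₂)
  UniqueAlphaSet G u I = IsAlphaSet G u I × (∀ J → IsAlphaSet G u J → J ≡ I)

-- Let I be the unique α-set of (G, w).  Every other independent
-- set J then has a strictly positive gap  w(I) - w(J).  There are only
-- finitely many subsets, so some δ > 0 lies below every positive gap.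
-- Choose ε > 0 with 2nε < δ.  If w' differs from w by less than ε at
-- each of the n vertices, then every weight changes by at most nε, so
-- w'(J) ≤ w(J) + nε < w(I) - nε ≤ w'(I): I strictly dominates every
-- other independent set for w', hence is again the unique α-set.

module Submission where

open import Defs
open import Data.Nat using (ℕ)
open import Data.Fin using (Fin)
open import Data.Fin.Subset using (Subset)
open import Data.Product using (_×_; Σ)

import Data.Nat as ℕ
open import Level using (_⊔_)
open import Data.Product using (_,_; proj₁; proj₂)
open import Data.Sum using (inj₁; inj₂)
open import Data.Vec using ([]; _∷_)
open import Data.Bool using (true; false)
import Data.Bool as Bool
open import Data.Vec.Properties using (≡-dec)
open import Data.Empty using (⊥-elim)
open import Relation.Nullary using (yes; no; ¬_)
open import Relation.Binary.Bundles using (StrictPartialOrder)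
open import Relation.Binary.Definitions using (tri<; tri≈; tri>)
open import Relation.Binary.PropositionalEquality using (_≡_; _≢_)
import Relation.Binary.PropositionalEquality as ≡
import Relation.Binary.Structures as Structures
import Relation.Binary.Reasoning.StrictPartialOrder as StrictReasoning
import Algebra.Properties.Ring as RingProperties
import Algebra.Properties.Group as GroupProperties
import Algebra.Properties.CommutativeSemigroup as CommSemigroupProperties
import Algebra.Properties.Semiring.Mult as SemiringMult

module OrderedFieldProperties {c ℓ₁ ℓ₂} (F : OrderedField c ℓ₁ ℓ₂) where
  open OrderedField F public hiding (_<_; _≤_)

  infix 4 _<_ _≤_
  _<_ : Carrier → Carrier → Set ℓ₂
  _<_ = OrderedField._<_ F
  _≤_ : Carrier → Carrier → Set (ℓ₁ ⊔ ℓ₂)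
  _≤_ = OrderedField._≤_ F

  module STO = Structures.IsStrictTotalOrder isStrictTotalOrder
  open RingProperties ring using (-1*x≈-x; -‿distribʳ-*)
  open GroupProperties +-group using (⁻¹-involutive; //-rightDividesˡ; //-rightDividesʳ)

  strictPartialOrder : StrictPartialOrder c ℓ₁ ℓ₂
  strictPartialOrder = record { isStrictPartialOrder = STO.isStrictPartialOrder }

  -- Chains mixing _<_, _≤_ and _≈_ (the reasoning module's _≤_ is ours).
  open StrictReasoning strictPartialOrder public

  <-resp-≈ : ∀ {a a' b b'} → a ≈ a' → b ≈ b' → a < b → a' < b'
  <-resp-≈ a≈a' b≈b' a<b = STO.<-respʳ-≈ b≈b' (STO.<-respˡ-≈ a≈a' a<b)

  ≤-refl : ∀ {a} → a ≤ a
  ≤-refl = inj₂ refl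

  <⇒≱ : ∀ {a b} → a < b → ¬ (b ≤ a)
  <⇒≱ a<b (inj₁ b<a) = STO.asym a<b b<a
  <⇒≱ a<b (inj₂ b≈a) = STO.irrefl (sym b≈a) a<b

  ≤-trans : ∀ {a b d} → a ≤ b → b ≤ d → a ≤ d
  ≤-trans {a} {b} {d} a≤b b≤d = begin a ≤⟨ a≤b ⟩ b ≤⟨ b≤d ⟩ d ∎

  +-monoʳ-< : ∀ {a b} z → a < b → z + a < z + b
  +-monoʳ-< {a} {b} z a<b = <-resp-≈ (+-comm a z) (+-comm b z) (+-mono-< z a<b)

  +-monoˡ-≤ : ∀ {a b} z → a ≤ b → a + z ≤ b + z
  +-monoˡ-≤ z (inj₁ a<b) = inj₁ (+-mono-< z a<b)
  +-monoˡ-≤ z (inj₂ a≈b) = inj₂ (+-cong a≈b refl)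

  +-monoʳ-≤ : ∀ {a b} z → a ≤ b → z + a ≤ z + b
  +-monoʳ-≤ z (inj₁ a<b) = inj₁ (+-monoʳ-< z a<b)
  +-monoʳ-≤ z (inj₂ a≈b) = inj₂ (+-cong refl a≈b)

  +-mono-≤ : ∀ {a b x y} → a ≤ b → x ≤ y → a + x ≤ b + y
  +-mono-≤ {a} {b} {x} {y} a≤b x≤y = begin
    a + x  ≤⟨ +-monoˡ-≤ x a≤b ⟩
    b + x  ≤⟨ +-monoʳ-≤ b x≤y ⟩
    b + y  ∎

  x≤z+x : ∀ {z} x → 0# ≤ z → x ≤ z + x
  x≤z+x {z} x 0≤z = begin
    x        ≈⟨ +-identityˡ x ⟨
    0# + x   ≤⟨ +-monoˡ-≤ x 0≤z ⟩
    z + x    ∎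

  +-cancelʳ-< : ∀ {a b} z → a + z < b + z → a < b
  +-cancelʳ-< {a} {b} z p =
    <-resp-≈ (//-rightDividesʳ z a) (//-rightDividesʳ z b) (+-mono-< (- z) p)

  x-z<y⇒x<y+z : ∀ {x y} z → x - z < y → x < y + z
  x-z<y⇒x<y+z {x} z p = <-resp-≈ (//-rightDividesˡ z x) refl (+-mono-< z p)

  x<y⇒0<y-x : ∀ {x y} → x < y → 0# < y - x
  x<y⇒0<y-x {x} p = <-resp-≈ (-‿inverseʳ x) refl (+-mono-< (- x) p)

  x+[y-x]≈y : ∀ x y → x + (y - x) ≈ y
  x+[y-x]≈y x y = trans (+-comm x (y - x)) (//-rightDividesˡ x y)

  0<x⇒-x<0 : ∀ {x} → 0# < x → - x < 0#
  0<x⇒-x<0 {x} p = <-resp-≈ (+-identityˡ (- x)) (-‿inverseʳ x) (+-mono-< (- x) p)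

  x<0⇒0<-x : ∀ {x} → x < 0# → 0# < - x
  x<0⇒0<-x {x} p = <-resp-≈ (-‿inverseʳ x) (+-identityˡ (- x)) (+-mono-< (- x) p)

  -- 1 is positive: otherwise 0 < -1, and then 0 < (-1)(-1) = 1.
  0<1 : 0# < 1#
  0<1 with STO.compare 0# 1#
  ... | tri< 0<1 _ _ = 0<1
  ... | tri≈ _ 0≈1 _ = ⊥-elim (0≉1 0≈1)
  ... | tri> _ _ 1<0 = ⊥-elim (STO.asym 1<0 (<-resp-≈ refl square (*-pos 0<-1 0<-1)))
    where
    0<-1 : 0# < - 1#
    0<-1 = x<0⇒0<-x 1<0
    square : - 1# * - 1# ≈ 1#
    square = trans (-1*x≈-x (- 1#)) (⁻¹-involutive 1#)

  inverse-pos : ∀ {m y} → 0# < m → m * y ≈ 1# → 0# < y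
  inverse-pos {m} {y} 0<m my≈1 with STO.compare 0# y
  ... | tri< 0<y _ _ = 0<y
  ... | tri≈ _ 0≈y _ = ⊥-elim (0≉1 (trans (sym (zeroʳ m)) (trans (*-cong refl 0≈y) my≈1)))
  ... | tri> _ _ y<0 = ⊥-elim (STO.asym (0<x⇒-x<0 0<1) 0<-1)
    where
    0<-1 : 0# < - 1#
    0<-1 = <-resp-≈ refl (trans (sym (-‿distribʳ-* m y)) (-‿cong my≈1))
                   (*-pos 0<m (x<0⇒0<-x y<0))

  positiveBelow : ∀ a {d} → 0# < d →
    Σ Carrier (λ δ → 0# < δ × δ ≤ d × (0# < a → δ ≤ a))
  positiveBelow a {d} 0<d with STO.compare 0# a
  ... | tri≈ 0≮a _ _ = d , 0<d , ≤-refl , λ 0<a → ⊥-elim (0≮a 0<a)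
  ... | tri> 0≮a _ _ = d , 0<d , ≤-refl , λ 0<a → ⊥-elim (0≮a 0<a)
  ... | tri< 0<a _ _ with STO.compare a d
  ...   | tri< a<d _ _ = a , 0<a , inj₁ a<d , λ _ → ≤-refl
  ...   | tri≈ _ a≈d _ = d , 0<d , ≤-refl , λ _ → inj₂ (sym a≈d)
  ...   | tri> _ _ d<a = d , 0<d , ≤-refl , λ _ → inj₁ d<a

module Multiples {c ℓ₁ ℓ₂} (F : OrderedField c ℓ₁ ℓ₂) where
  open OrderedFieldProperties F
  open SemiringMult semiring public using (×-homo-+) renaming (_×_ to _×ₙ_)
  open SemiringMult semiring using (×-congʳ; ×-assoc-*)

  ×-nonneg : ∀ k {x} → 0# ≤ x → 0# ≤ k ×ₙ x
  ×-nonneg ℕ.zero    0≤x = ≤-refl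
  ×-nonneg (ℕ.suc k) 0≤x = begin
    0#           ≈⟨ +-identityʳ 0# ⟨
    0# + 0#      ≤⟨ +-mono-≤ 0≤x (×-nonneg k 0≤x) ⟩
    _ + k ×ₙ _   ∎

  -- For every δ > 0 and every k there is ε > 0 with k ×ₙ ε < δ:
  -- take ε = δ / (k + 1), so that (k + 1) ×ₙ ε = δ.
  divide : ∀ k {δ} → 0# < δ → Σ Carrier (λ ε → 0# < ε × k ×ₙ ε < δ)
  divide k {δ} 0<δ = ε , 0<ε , k×ε<δ
    where
    m : Carrier
    m = ℕ.suc k ×ₙ 1#
    0<m : 0# < m
    0<m = begin-strict
      0#           <⟨ 0<1 ⟩
      1#           ≈⟨ +-identityʳ 1# ⟨
      1# + 0#      ≤⟨ +-monoʳ-≤ 1# (×-nonneg k (inj₁ 0<1)) ⟩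
      m            ∎
    m⁻¹ : Σ Carrier (λ y → m * y ≈ 1#)
    m⁻¹ = inverse m (λ m≈0 → STO.irrefl (sym m≈0) 0<m)
    ε : Carrier
    ε = proj₁ m⁻¹ * δ
    0<ε : 0# < ε
    0<ε = *-pos (inverse-pos 0<m (proj₂ m⁻¹)) 0<δ
    k×ε<δ : k ×ₙ ε < δ
    k×ε<δ = begin-strict
      k ×ₙ ε                  ≈⟨ +-identityˡ (k ×ₙ ε) ⟨
      0# + k ×ₙ ε             <⟨ +-mono-< (k ×ₙ ε) 0<ε ⟩
      ℕ.suc k ×ₙ ε            ≈⟨ ×-congʳ (ℕ.suc k) (*-identityˡ ε) ⟨
      ℕ.suc k ×ₙ (1# * ε)     ≈⟨ ×-assoc-* (ℕ.suc k) 1# ε ⟨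
      m * (proj₁ m⁻¹ * δ)    ≈⟨ *-assoc m (proj₁ m⁻¹) δ ⟨
      (m * proj₁ m⁻¹) * δ    ≈⟨ *-cong (proj₂ m⁻¹) refl ⟩
      1# * δ                 ≈⟨ *-identityˡ δ ⟩
      δ                      ∎

-- A function on the finitely many subsets of Fin n has a positive lower
-- bound on the set where it is positive.  This is where finiteness of the
-- graph enters.
module FiniteLowerBound {c ℓ₁ ℓ₂} (F : OrderedField c ℓ₁ ℓ₂) where
  open OrderedFieldProperties F

  belowPositiveValues : ∀ n (f : Subset n → Carrier) →
    Σ Carrier (λ δ → 0# < δ × (∀ S → 0# < f S → δ ≤ f S))
  belowPositiveValues ℕ.zero f with positiveBelow (f []) 0<1
  ... | δ , 0<δ , _ , δ≤f = δ , 0<δ , λ { [] → δ≤f }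
  belowPositiveValues (ℕ.suc n) f
    with belowPositiveValues n (λ S → f (true ∷ S))
       | belowPositiveValues n (λ S → f (false ∷ S))
  ... | δ₁ , 0<δ₁ , δ₁≤f₁ | δ₀ , 0<δ₀ , δ₀≤f₀ with positiveBelow δ₀ 0<δ₁
  ...   | δ , 0<δ , δ≤δ₁ , δ≤δ₀ = δ , 0<δ , below
    where
    below : ∀ S → 0# < f S → δ ≤ f S
    below (true  ∷ S) 0<f = ≤-trans δ≤δ₁ (δ₁≤f₁ S 0<f)
    below (false ∷ S) 0<f = ≤-trans (δ≤δ₀ 0<δ₀) (δ₀≤f₀ S 0<f)

module Perturbation {c ℓ₁ ℓ₂} (F : OrderedField c ℓ₁ ℓ₂) where
  open OrderedFieldProperties F
  open Multiples F
  open CommSemigroupProperties +-commutativeSemigroup using (interchange)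

  weight-perturbation : ∀ {n} {u v : Fin n → Carrier} {ε} → 0# ≤ ε →
    (∀ x → u x ≤ v x + ε) → ∀ S → weight F u S ≤ weight F v S + n ×ₙ ε
  weight-perturbation {ℕ.zero} 0≤ε u≤v+ε [] = inj₂ (sym (+-identityʳ 0#))
  weight-perturbation {ℕ.suc n} {u} {v} {ε} 0≤ε u≤v+ε (true ∷ S) = begin
    u Fin.zero + weight F u₊ S                      ≤⟨ +-mono-≤ (u≤v+ε Fin.zero) rest ⟩
    (v Fin.zero + ε) + (weight F v₊ S + n ×ₙ ε)     ≈⟨ interchange _ _ _ _ ⟩
    (v Fin.zero + weight F v₊ S) + (ε + n ×ₙ ε)     ∎
    where
    u₊ v₊ : Fin n → Carrier
    u₊ i = u (Fin.suc i)
    v₊ i = v (Fin.suc i)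
    rest : weight F u₊ S ≤ weight F v₊ S + n ×ₙ ε
    rest = weight-perturbation 0≤ε (λ i → u≤v+ε (Fin.suc i)) S
  weight-perturbation {ℕ.suc n} {u} {v} {ε} 0≤ε u≤v+ε (false ∷ S) = begin
    weight F u₊ S                  ≤⟨ weight-perturbation 0≤ε (λ i → u≤v+ε (Fin.suc i)) S ⟩
    weight F v₊ S + n ×ₙ ε         ≤⟨ +-monoʳ-≤ (weight F v₊ S) (x≤z+x (n ×ₙ ε) 0≤ε) ⟩
    weight F v₊ S + (ε + n ×ₙ ε)   ∎
    where
    u₊ v₊ : Fin n → Carrier
    u₊ i = u (Fin.suc i)
    v₊ i = v (Fin.suc i)

  perturbation-preserves-< : ∀ {n} {w w' : Fin n → Carrier} {ε} → 0# ≤ ε →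
    (∀ x → w' x ≤ w x + ε) → (∀ x → w x ≤ w' x + ε) → ∀ J I →
    weight F w J + (n ×ₙ ε + n ×ₙ ε) < weight F w I → weight F w' J < weight F w' I
  perturbation-preserves-< {n} {w} {w'} {ε} 0≤ε w'≤w+ε w≤w'+ε J I margin = begin-strict
    weight F w' J       ≤⟨ weight-perturbation 0≤ε w'≤w+ε J ⟩
    weight F w J + N    <⟨ +-cancelʳ-< N shifted ⟩
    weight F w' I       ∎
    where
    N : Carrier
    N = n ×ₙ ε
    shifted : (weight F w J + N) + N < weight F w' I + N
    shifted = begin-strict
      (weight F w J + N) + N   ≈⟨ +-assoc _ N N ⟩
      weight F w J + (N + N)   <⟨ margin ⟩
      weight F w I             ≤⟨ weight-perturbation 0≤ε w≤w'+ε I ⟩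
      weight F w' I + N        ∎

module UniqueAlphaSets {c ℓ₁ ℓ₂} (F : OrderedField c ℓ₁ ℓ₂) {n : ℕ} (G : Graph n) where
  open OrderedFieldProperties F

  StrictlyDominant : (Fin n → Carrier) → Subset n → Set ℓ₂
  StrictlyDominant u I = Independent F G I ×
    (∀ J → Independent F G J → J ≢ I → weight F u J < weight F u I)

  -- An independent set J ≠ I of the same weight as the α-set I would be
  -- a second α-set.
  unique⇒dominant : ∀ {u I} → UniqueAlphaSet F G u I → StrictlyDominant u I
  unique⇒dominant {u} {I} ((indI , maxI) , uniqueI) = indI , dominated
    where
    dominated : ∀ J → Independent F G J → J ≢ I → weight F u J < weight F u I
    dominated J indJ J≢I with maxI J indJ
    ... | inj₁ J<I = J<I
    ... | inj₂ J≈I = ⊥-elim (J≢I (uniqueI J (indJ , λ K indK → ≤-trans (maxI K indK) (inj₂ (sym J≈I)))))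

  dominant⇒unique : ∀ {u I} → StrictlyDominant u I → UniqueAlphaSet F G u I
  dominant⇒unique {u} {I} (indI , dominates) = (indI , maximum) , unique
    where
    maximum : ∀ J → Independent F G J → weight F u J ≤ weight F u I
    maximum J indJ with ≡-dec Bool._≟_ J I
    ... | yes ≡.refl = ≤-refl
    ... | no J≢I  = inj₁ (dominates J indJ J≢I)
    unique : ∀ J → IsAlphaSet F G u J → J ≡ I
    unique J (indJ , maxJ) with ≡-dec Bool._≟_ J I
    ... | yes J≡I = J≡I
    ... | no J≢I  = ⊥-elim (<⇒≱ (dominates J indJ J≢I) (maxJ I indI))

module Stability {c ℓ₁ ℓ₂} (F : OrderedField c ℓ₁ ℓ₂) {n : ℕ} (G : Graph n) where
  open OrderedFieldProperties F
  open Multiples F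
  open Perturbation F
  open UniqueAlphaSets F G

  margin⇒stable : ∀ {w I ε} → 0# < ε → Independent F G I →
    (∀ J → Independent F G J → J ≢ I →
       weight F w J + (n ×ₙ ε + n ×ₙ ε) < weight F w I) →
    ∀ w' → (∀ x → w x - ε < w' x × w' x < w x + ε) → UniqueAlphaSet F G w' I
  margin⇒stable {w} {I} {ε} 0<ε indI margin w' close =
    dominant⇒unique (indI , λ J indJ J≢I →
      perturbation-preserves-< (inj₁ 0<ε) w'≤w+ε w≤w'+ε J I (margin J indJ J≢I))
    where
    w'≤w+ε : ∀ x → w' x ≤ w x + ε
    w'≤w+ε x = inj₁ (proj₂ (close x))
    w≤w'+ε : ∀ x → w x ≤ w' x + ε
    w≤w'+ε x = inj₁ (x-z<y⇒x<y+z ε (proj₁ (close x)))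

-- Theorem 2.9.  Let δ > 0 lie below every positive gap w(I) - w(J)
-- (positive gaps are exactly those of independent J ≠ I), and choose
-- ε > 0 with 2nε < δ; then the margin condition of margin⇒stable holds.
theorem2p9 : ∀ {c ℓ₁ ℓ₂} (F : OrderedField c ℓ₁ ℓ₂) (n : ℕ) (G : Graph n)
    (w : Fin n → OrderedField.Carrier F) →
    (∀ x → OrderedField._≤_ F (OrderedField.0# F) (w x)) →
    (I : Subset n) → UniqueAlphaSet F G w I →
    Σ (OrderedField.Carrier F) (λ ε →
    OrderedField._<_ F (OrderedField.0# F) ε ×
    ((w' : Fin n → OrderedField.Carrier F) →
    (∀ x → OrderedField._<_ F (OrderedField._-_ F (w x) ε) (w' x) ×
    OrderedField._<_ F (w' x) (OrderedField._+_ F (w x) ε)) →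
    UniqueAlphaSet F G w' I))
theorem2p9 F n G w _ I unique
  with UniqueAlphaSets.unique⇒dominant F G unique
     | FiniteLowerBound.belowPositiveValues F n (λ J → OrderedField._-_ F (weight F w I) (weight F w J))
... | indI , dominates | δ , 0<δ , δ≤gap with Multiples.divide F (n ℕ.+ n) 0<δ
... | ε , 0<ε , 2nε<δ = ε , 0<ε , Stability.margin⇒stable F G 0<ε indI margin
  where
  open OrderedFieldProperties F
  open Multiples F using (_×ₙ_; ×-homo-+)

  margin : ∀ J → Independent F G J → J ≢ I →
    weight F w J + (n ×ₙ ε + n ×ₙ ε) < weight F w I
  margin J indJ J≢I = begin-strict
    weight F w J + (n ×ₙ ε + n ×ₙ ε)              ≈⟨ +-cong refl (×-homo-+ ε n n) ⟨
    weight F w J + (n ℕ.+ n) ×ₙ ε                 <⟨ +-monoʳ-< (weight F w J) 2nε<δ ⟩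
    weight F w J + δ                              ≤⟨ +-monoʳ-≤ (weight F w J) (δ≤gap J 0<gap) ⟩
    weight F w J + (weight F w I - weight F w J)  ≈⟨ x+[y-x]≈y _ _ ⟩
    weight F w I                                  ∎
    where
    0<gap : 0# < weight F w I - weight F w J
    0<gap = x<y⇒0<y-x (dominates J indJ J≢I)
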